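{- Every $G\in\mathscr{F}_{n,3}$ contains the edges $(i,i+1)$ for all $i\in[n]$, together with a second copy of $(1,2)$ and a second copy of $(n,n+1)$; i.e. $\{(i,i+1): i\in[n]\}\cup\{(1,2),(n,n+1)\}\subseteq E(G)$ as multisets.
   Context: DAGs have vertex set $[n+1]$ and a multiset of edges $(i,j)$ with $i<j$ (parallel edges allowed, counted with multiplicity). $\mathscr{F}_{n,3}$ is the set of such DAGs with out-degree sequence $(3,2,\dots,2,0)$ and in-degree sequence $(0,2,\dots,2,3)$. -}

module Defs where

open import Data.Nat using (ℕ; zero; suc; _+_; _<_; _≤_)
open import Data.Fin using (Fin; toℕ; inject₁) renaming (suc to fsuc)
open import Data.List using (map; allFin)
open import Data.Nat.ListAction using (sum)
open import Relation.Binary.PropositionalEquality using (_≡_)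
open import Data.Product using (_×_)

-- Vertex k ∈ [n+1] is represented by  v : Fin (suc n)  with  toℕ v = k - 1.
-- The edge multiset is given by its multiplicity function.
record DAG (n : ℕ) : Set where
  field
    mult    : Fin (suc n) → Fin (suc n) → ℕ
    forward : ∀ i j → 0 < mult i j → toℕ i < toℕ j

open DAG public

outdeg : ∀ {n} → DAG n → Fin (suc n) → ℕ
outdeg {n} G i = sum (map (λ j → mult G i j) (allFin (suc n)))

indeg : ∀ {n} → DAG n → Fin (suc n) → ℕ
indeg {n} G j = sum (map (λ i → mult G i j) (allFin (suc n)))

δ : ℕ → ℕ → ℕ
δ zero    zero    = 1
δ zero    (suc _) = 0
δ (suc _) zero    = 0
δ (suc a) (suc b) = δ a b

-- out-degree sequence (3,2,…,2,0) indexed by k = vertex - 1 ∈ {0,…,n}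
outSeqℕ : ℕ → ℕ → ℕ
outSeqℕ n zero = 3
outSeqℕ n (suc k) with δ (suc k) n
... | zero  = 2
... | suc _ = 0

inSeqℕ : ℕ → ℕ → ℕ
inSeqℕ n zero = 0
inSeqℕ n (suc k) with δ (suc k) n
... | zero  = 2
... | suc _ = 3

inF3 : ∀ {n} → DAG n → Set
inF3 {n} G = (∀ v → outdeg G v ≡ outSeqℕ n (toℕ v))
           × (∀ v → indeg G v ≡ inSeqℕ n (toℕ v))

-- required multiplicity of edge (i,i+1), i = toℕ e + 1 ∈ [n], in the multiset
-- {(i,i+1) : i ∈ [n]} ⊎ {(1,2),(n,n+1)}  (multiset sum)
required : (n : ℕ) → Fin n → ℕ
required n e = 1 + δ (toℕ e) 0 + δ (suc (toℕ e)) n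

-- Cut the vertex set between i and i + 1.  Out-degrees on {1, …, i} sum to 2i + 1 and
-- in-degrees to 2i − 2; every edge entering {1, …, i} starts there, so exactly 3 edges
-- cross the cut.  All edges out of i cross it, and so do all edges into i + 1 except
-- those coming from i.  Hence indeg(i + 1) + outdeg(i) ≤ 3 + mult(i, i + 1), which is
-- the claimed bound.
module Submission where

open import Defs
open import Data.Nat using (ℕ; zero; suc; _+_; _*_; _∸_; _<_; _≤_; z≤n; s≤s; s≤s⁻¹; z<s; s<s; _<?_)
open import Data.Nat.Properties
open import Data.Nat.Tactic.RingSolver using (solve-∀)
open import Algebra.Properties.CommutativeSemigroup +-commutativeSemigroup using (interchange; xy∙z≈xz∙y)
open import Data.Nat.ListAction using (sum)
open import Data.Fin using (Fin; toℕ; fromℕ<; inject₁) renaming (zero to fzero; suc to fsuc)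
open import Data.Fin.Properties using (toℕ<n; toℕ-fromℕ<; fromℕ<-toℕ; toℕ-inject₁)
open import Data.List using (tabulate)
open import Data.List.Properties using (map-tabulate)
open import Data.Product using (_,_)
open import Function using (_∘_; id)
open import Relation.Nullary using (yes; no; contradiction)
open import Relation.Binary.PropositionalEquality

∑ : ℕ → (ℕ → ℕ) → ℕ
∑ zero    f = 0
∑ (suc k) f = f 0 + ∑ k (f ∘ suc)

syntax ∑ k (λ i → e) = ∑[ i < k ] e

∑-cong : ∀ k {f g : ℕ → ℕ} → (∀ {i} → i < k → f i ≡ g i) → ∑ k f ≡ ∑ k g
∑-cong zero    eq = refl
∑-cong (suc k) eq = cong₂ _+_ (eq z<s) (∑-cong k (eq ∘ s<s))

∑-const : ∀ k c → ∑[ _ < k ] c ≡ k * c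
∑-const zero    c = refl
∑-const (suc k) c = cong (c +_) (∑-const k c)

∑-zero : ∀ k {f : ℕ → ℕ} → (∀ {i} → i < k → f i ≡ 0) → ∑ k f ≡ 0
∑-zero k eq = trans (∑-cong k eq) (trans (∑-const k 0) (*-zeroʳ k))

∑-mono-≤ : ∀ k {f g : ℕ → ℕ} → (∀ i → f i ≤ g i) → ∑ k f ≤ ∑ k g
∑-mono-≤ zero    le = z≤n
∑-mono-≤ (suc k) le = +-mono-≤ (le 0) (∑-mono-≤ k (le ∘ suc))

term≤∑ : ∀ {k i} (f : ℕ → ℕ) → i < k → f i ≤ ∑ k f
term≤∑ {suc k} {zero}  f z<s       = m≤m+n (f 0) _
term≤∑ {suc k} {suc i} f (s<s i<k) = ≤-trans (term≤∑ (f ∘ suc) i<k) (m≤n+m _ (f 0))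

∑-distrib-+ : ∀ k (f g : ℕ → ℕ) → ∑[ i < k ] (f i + g i) ≡ ∑ k f + ∑ k g
∑-distrib-+ zero    f g = refl
∑-distrib-+ (suc k) f g =
  trans (cong (f 0 + g 0 +_) (∑-distrib-+ k (f ∘ suc) (g ∘ suc)))
        (interchange (f 0) (g 0) _ _)

∑-++ : ∀ a b (f : ℕ → ℕ) → ∑ (a + b) f ≡ ∑ a f + ∑[ t < b ] f (a + t)
∑-++ zero    b f = refl
∑-++ (suc a) b f = trans (cong (f 0 +_) (∑-++ a b (f ∘ suc))) (sym (+-assoc (f 0) _ _))

∑-splitAt : ∀ {a N} (f : ℕ → ℕ) → a ≤ N → ∑ N f ≡ ∑ a f + ∑[ t < N ∸ a ] f (a + t)
∑-splitAt {a} {N} f a≤N = trans (cong (λ k → ∑ k f) (sym (m+[n∸m]≡n a≤N))) (∑-++ a (N ∸ a) f)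

∑-init-last : ∀ k (f : ℕ → ℕ) → ∑ (suc k) f ≡ ∑ k f + f k
∑-init-last zero    f = +-comm (f 0) 0
∑-init-last (suc k) f =
  trans (cong (f 0 +_) (∑-init-last k (f ∘ suc))) (sym (+-assoc (f 0) _ _))

∑-comm : ∀ a b (M : ℕ → ℕ → ℕ) → ∑[ i < a ] ∑[ j < b ] M i j ≡ ∑[ j < b ] ∑[ i < a ] M i j
∑-comm zero    b M = sym (∑-zero b (λ _ → refl))
∑-comm (suc a) b M =
  trans (cong (∑ b (M 0) +_) (∑-comm a b (M ∘ suc)))
        (sym (∑-distrib-+ b (M 0) (λ j → ∑[ i < a ] M (suc i) j)))

sum-tabulate : ∀ {m} {f : Fin m → ℕ} {g : ℕ → ℕ} → (∀ v → f v ≡ g (toℕ v)) →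
  sum (tabulate f) ≡ ∑ m g
sum-tabulate {zero}  eq = refl
sum-tabulate {suc m} eq = cong₂ _+_ (eq fzero) (sum-tabulate (eq ∘ fsuc))

StrictlyUpper : (ℕ → ℕ → ℕ) → Set
StrictlyUpper M = ∀ {i j} → j ≤ i → M i j ≡ 0

module _ (M : ℕ → ℕ → ℕ) where

  rowSum : ℕ → ℕ → ℕ
  rowSum N i = ∑[ j < N ] M i j

  colSum : ℕ → ℕ → ℕ
  colSum N j = ∑[ i < N ] M i j

  crossing : ℕ → ℕ → ℕ
  crossing N a = ∑[ i < a ] ∑[ t < N ∸ a ] M i (a + t)

  module _ (upper : StrictlyUpper M) where

    colSum-prefix : ∀ {a N j} → j ≤ a → a ≤ N → colSum N j ≡ colSum a j
    colSum-prefix {a} {N} {j} j≤a a≤N = begin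
      colSum N j                               ≡⟨ ∑-splitAt (λ i → M i j) a≤N ⟩
      colSum a j + ∑[ t < N ∸ a ] M (a + t) j  ≡⟨ cong (colSum a j +_) (∑-zero (N ∸ a) below) ⟩
      colSum a j + 0                           ≡⟨ +-identityʳ _ ⟩
      colSum a j                               ∎
      where
      open ≡-Reasoning
      below : ∀ {t} → t < N ∸ a → M (a + t) j ≡ 0
      below {t} _ = upper (≤-trans j≤a (m≤m+n a t))

    flow-conservation : ∀ {a N} → a ≤ N →
      ∑[ i < a ] rowSum N i ≡ ∑[ j < a ] colSum N j + crossing N a
    flow-conservation {a} {N} a≤N = begin
      ∑[ i < a ] rowSum N i
        ≡⟨ ∑-cong a (λ _ → ∑-splitAt _ a≤N) ⟩
      ∑[ i < a ] (rowSum a i + ∑[ t < N ∸ a ] M i (a + t))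
        ≡⟨ ∑-distrib-+ a (rowSum a) _ ⟩
      ∑[ i < a ] rowSum a i + crossing N a
        ≡⟨ cong (_+ crossing N a) (∑-comm a a M) ⟩
      ∑[ j < a ] colSum a j + crossing N a
        ≡⟨ cong (_+ crossing N a) (∑-cong a (λ j<a → sym (colSum-prefix (<⇒≤ j<a) a≤N))) ⟩
      ∑[ j < a ] colSum N j + crossing N a
        ∎
      where open ≡-Reasoning

    -- Row b lies across the cut after b, and the entries of column b + 1 outside row b cross it too.
    edge-bound : ∀ {b N} → suc b < N →
      colSum N (suc b) + rowSum N b ≤ crossing N (suc b) + M b (suc b)
    edge-bound {b} {N} b+1<N = begin
      colSum N a + rowSum N b
        ≡⟨ cong₂ _+_ column row ⟩
      ∑[ i < b ] M i a + M b a + R b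
        ≤⟨ +-monoˡ-≤ (R b) (+-monoˡ-≤ (M b a) (∑-mono-≤ b entry≤R)) ⟩
      ∑[ i < b ] R i + M b a + R b
        ≡⟨ xy∙z≈xz∙y _ (M b a) (R b) ⟩
      ∑[ i < b ] R i + R b + M b a
        ≡⟨ cong (_+ M b a) (sym (∑-init-last b R)) ⟩
      crossing N a + M b a
        ∎
      where
      open ≤-Reasoning
      a = suc b
      R : ℕ → ℕ
      R i = ∑[ t < N ∸ a ] M i (a + t)
      column : colSum N a ≡ ∑[ i < b ] M i a + M b a
      column = trans (colSum-prefix ≤-refl (<⇒≤ b+1<N)) (∑-init-last b (λ i → M i a))
      row : rowSum N b ≡ R b
      row = trans (∑-splitAt (M b) (<⇒≤ b+1<N)) (cong (_+ R b) (∑-zero a (upper ∘ s≤s⁻¹)))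
      entry≤R : ∀ i → M i a ≤ R i
      entry≤R i = subst (λ k → M i k ≤ R i) (+-identityʳ a)
                        (term≤∑ (λ t → M i (a + t)) (m<n⇒0<n∸m b+1<N))

δ-< : ∀ {a b} → a < b → δ a b ≡ 0
δ-< {zero}  {suc b} _         = refl
δ-< {suc a} {suc b} (s<s a<b) = δ-< a<b

δ≤1 : ∀ a b → δ a b ≤ 1
δ≤1 zero    zero    = ≤-refl
δ≤1 zero    (suc b) = z≤n
δ≤1 (suc a) zero    = z≤n
δ≤1 (suc a) (suc b) = δ≤1 a b

outSeq-interior : ∀ {n b} → b < n → outSeqℕ n b ≡ 2 + δ b 0
outSeq-interior {n} {zero}  _   = refl
outSeq-interior {n} {suc b} b<n rewrite δ-< b<n = refl

inSeq-suc : ∀ n k → inSeqℕ n (suc k) ≡ 2 + δ (suc k) n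
inSeq-suc n k with δ (suc k) n | δ≤1 (suc k) n
... | zero        | _         = refl
... | suc zero    | _         = refl
... | suc (suc _) | s≤s ()

outSeq-prefix : ∀ {n b} → b < n → ∑[ i < suc b ] outSeqℕ n i ≡ 3 + b * 2
outSeq-prefix {n} {b} b<n =
  cong (3 +_) (trans (∑-cong b (λ i<b → outSeq-interior (≤-<-trans i<b b<n))) (∑-const b 2))

inSeq-prefix : ∀ {n b} → b < n → ∑[ i < suc b ] inSeqℕ n i ≡ b * 2
inSeq-prefix {n} {b} b<n = trans (∑-cong b interior) (∑-const b 2)
  where
  interior : ∀ {i} → i < b → inSeqℕ n (suc i) ≡ 2
  interior {i} i<b = trans (inSeq-suc n i) (cong (2 +_) (δ-< (≤-<-trans i<b b<n)))

module _ {n : ℕ} {M : ℕ → ℕ → ℕ} (upper : StrictlyUpper M)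
         (rows : ∀ {i} → i ≤ n → rowSum M (suc n) i ≡ outSeqℕ n i)
         (cols : ∀ {j} → j ≤ n → colSum M (suc n) j ≡ inSeqℕ n j) where

  crossing≡3 : ∀ {b} → b < n → crossing M (suc n) (suc b) ≡ 3
  crossing≡3 {b} b<n = +-cancelˡ-≡ (b * 2) _ _ (begin
    b * 2 + crossing M (suc n) (suc b)
      ≡⟨ cong (_+ crossing M (suc n) (suc b)) (sym colPrefix) ⟩
    ∑[ j < suc b ] colSum M (suc n) j + crossing M (suc n) (suc b)
      ≡⟨ sym (flow-conservation M upper (s≤s (<⇒≤ b<n))) ⟩
    ∑[ i < suc b ] rowSum M (suc n) i
      ≡⟨ rowPrefix ⟩
    3 + b * 2
      ≡⟨ +-comm 3 (b * 2) ⟩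
    b * 2 + 3
      ∎)
    where
    open ≡-Reasoning
    inPrefix : ∀ {i} → i < suc b → i ≤ n
    inPrefix i<b+1 = ≤-trans (s≤s⁻¹ i<b+1) (<⇒≤ b<n)
    rowPrefix : ∑[ i < suc b ] rowSum M (suc n) i ≡ 3 + b * 2
    rowPrefix = trans (∑-cong (suc b) (rows ∘ inPrefix)) (outSeq-prefix b<n)
    colPrefix : ∑[ j < suc b ] colSum M (suc n) j ≡ b * 2
    colPrefix = trans (∑-cong (suc b) (cols ∘ inPrefix)) (inSeq-prefix b<n)

  consecutive-mult : ∀ {b} → b < n → 1 + δ b 0 + δ (suc b) n ≤ M b (suc b)
  consecutive-mult {b} b<n = +-cancelˡ-≤ 3 _ _ (begin
    3 + (1 + δ b 0 + δ (suc b) n)                  ≡⟨ rearrange (δ b 0) (δ (suc b) n) ⟩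
    (2 + δ (suc b) n) + (2 + δ b 0)                ≡⟨ sym (cong₂ _+_ column row) ⟩
    colSum M (suc n) (suc b) + rowSum M (suc n) b  ≤⟨ edge-bound M upper (s≤s b<n) ⟩
    crossing M (suc n) (suc b) + M b (suc b)       ≡⟨ cong (_+ M b (suc b)) (crossing≡3 b<n) ⟩
    3 + M b (suc b)                                ∎)
    where
    open ≤-Reasoning
    rearrange : ∀ x y → 3 + (1 + x + y) ≡ (2 + y) + (2 + x)
    rearrange = solve-∀
    column : colSum M (suc n) (suc b) ≡ 2 + δ (suc b) n
    column = trans (cols b<n) (inSeq-suc n b)
    row : rowSum M (suc n) b ≡ 2 + δ b 0
    row = trans (rows (<⇒≤ b<n)) (outSeq-interior b<n)

-- The multiplicity matrix of G on ℕ × ℕ, extended by 0 outside [0, n] × [0, n].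
adjacency : ∀ {n} → DAG n → ℕ → ℕ → ℕ
adjacency {n} G i j with i <? suc n | j <? suc n
... | yes i≤n | yes j≤n = mult G (fromℕ< i≤n) (fromℕ< j≤n)
... | _       | _       = 0

adjacency-toℕ : ∀ {n} (G : DAG n) u v → adjacency G (toℕ u) (toℕ v) ≡ mult G u v
adjacency-toℕ {n} G u v with toℕ u <? suc n | toℕ v <? suc n
... | yes p | yes q = cong₂ (mult G) (fromℕ<-toℕ u p) (fromℕ<-toℕ v q)
... | no ¬p | _     = contradiction (toℕ<n u) ¬p
... | yes _ | no ¬q = contradiction (toℕ<n v) ¬q

mult-backward : ∀ {n} (G : DAG n) {u v} → toℕ v ≤ toℕ u → mult G u v ≡ 0
mult-backward G {u} {v} v≤u with mult G u v in eq
... | zero  = refl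
... | suc _ = contradiction (forward G u v (subst (0 <_) (sym eq) z<s)) (≤⇒≯ v≤u)

adjacency-upper : ∀ {n} (G : DAG n) → StrictlyUpper (adjacency G)
adjacency-upper {n} G {i} {j} j≤i with i <? suc n | j <? suc n
... | yes p | yes q = mult-backward G (subst₂ _≤_ (sym (toℕ-fromℕ< q)) (sym (toℕ-fromℕ< p)) j≤i)
... | yes _ | no _  = refl
... | no _  | _     = refl

outdeg≡rowSum : ∀ {n} (G : DAG n) u → outdeg G u ≡ rowSum (adjacency G) (suc n) (toℕ u)
outdeg≡rowSum G u =
  trans (cong sum (map-tabulate id (mult G u)))
        (sum-tabulate {g = adjacency G (toℕ u)} (sym ∘ adjacency-toℕ G u))

indeg≡colSum : ∀ {n} (G : DAG n) v → indeg G v ≡ colSum (adjacency G) (suc n) (toℕ v)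
indeg≡colSum G v =
  trans (cong sum (map-tabulate id (λ u → mult G u v)))
        (sum-tabulate {g = λ i → adjacency G i (toℕ v)} (λ u → sym (adjacency-toℕ G u v)))

toℕ-onto-≤ : ∀ {n} {P : ℕ → Set} → (∀ (u : Fin (suc n)) → P (toℕ u)) → ∀ {i} → i ≤ n → P i
toℕ-onto-≤ {P = P} p i≤n = subst P (toℕ-fromℕ< (s≤s i≤n)) (p (fromℕ< (s≤s i≤n)))

-- The hypothesis 1 ≤ n is implied by the existence of e : Fin n.
lemma3p1 : (n : ℕ) → 1 ≤ n → (G : DAG n) → inF3 G →
    (e : Fin n) → required n e ≤ mult G (inject₁ e) (fsuc e)
lemma3p1 n _ G (outdegs , indegs) e = begin
  required n e
    ≤⟨ consecutive-mult (adjacency-upper G) rows cols (toℕ<n e) ⟩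
  adjacency G (toℕ e) (suc (toℕ e))
    ≡⟨ cong (λ k → adjacency G k (suc (toℕ e))) (sym (toℕ-inject₁ e)) ⟩
  adjacency G (toℕ (inject₁ e)) (toℕ (fsuc e))
    ≡⟨ adjacency-toℕ G (inject₁ e) (fsuc e) ⟩
  mult G (inject₁ e) (fsuc e)
    ∎
  where
  open ≤-Reasoning
  rows : ∀ {i} → i ≤ n → rowSum (adjacency G) (suc n) i ≡ outSeqℕ n i
  rows = toℕ-onto-≤ (λ u → trans (sym (outdeg≡rowSum G u)) (outdegs u))
  cols : ∀ {j} → j ≤ n → colSum (adjacency G) (suc n) j ≡ inSeqℕ n j
  cols = toℕ-onto-≤ (λ v → trans (sym (indeg≡colSum G v)) (indegs v))
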